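{- Let $k\ge2$, $IS\in\{\Box,\blacksquare\}^k$, and let $\tau$ be a correct compositional translation from SYNCSIMPLE into $\mathrm{LOCKSIMPLE}_{k,IS}$. Then for every $1\le i\le k$, $$\#(P_i,\tau(!))+\#(P_i,\tau(?))\le\#(T_i,\tau(!))+\#(T_i,\tau(?)),$$ where $\#(S,r)$ denotes the number of occurrences of the symbol $S$ in the string $r$.
   Context: SYNCSIMPLE: subprocesses are generated by $\mathcal U::=\checkmark\mid 0\mid\ !\mathcal U\mid\ ?\mathcal U$; a process is a finite parallel composition of subprocesses, $\parallel$ associative and commutative with identity $0$. Reduction: $!\mathcal U_1\parallel ?\mathcal U_2\parallel\mathcal P\to\mathcal U_1\parallel\mathcal U_2\parallel\mathcal P$. Successful: of the form $\checkmark\parallel\mathcal P$. May-convergent: reduces (zero or more steps) to a successful process; must-convergent: every reachable process is may-convergent. $\mathrm{LOCKSIMPLE}_{k,IS}$ ($k$ locks, initial store $IS\in\{\Box,\blacksquare\}^k$, $\Box$ empty, $\blacksquare$ full): subprocesses $\mathcal U::=0\mid\checkmark\mid P_i\mathcal U\mid T_i\mathcal U$; processes are parallel compositions. States $(\mathcal P,\mathcal C)$; rules: $(P_i\mathcal U\parallel\mathcal P,\mathcal C)\to(\mathcal U\parallel\mathcal P,\mathcal C[C_i\mapsto\blacksquare])$ if $C_i=\Box$ (otherwise $P_i$ waits), and $(T_i\mathcal U\parallel\mathcal P,\mathcal C)\to(\mathcal U\parallel\mathcal P,\mathcal C[C_i\mapsto\Box])$ always. Successful state: process contains $\checkmark$;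 may-/must-convergence of states defined as for SYNCSIMPLE; a process $\mathcal P$ is may-/must-convergent iff $(\mathcal P,IS)$ is. Compositional translation: $\tau(0)=0$, $\tau(\checkmark)=\checkmark$, $\tau(\mathcal P_1\parallel\mathcal P_2)=\tau(\mathcal P_1)\parallel\tau(\mathcal P_2)$, $\tau(\mathcal U)$ has no $\parallel$, $\tau(!\mathcal U)=\tau(!)\tau(\mathcal U)$, $\tau(?\mathcal U)=\tau(?)\tau(\mathcal U)$, where $\tau(!),\tau(?)$ are strings over $\{P_i,T_i\}$. Correct: $\mathcal P$ may-convergent iff $\tau(\mathcal P)$ is, and $\mathcal P$ must-convergent iff $\tau(\mathcal P)$ is, for all $\mathcal P$. -}

module Defs where

open import Data.Nat using (ℕ; zero; suc; _+_)
open import Data.Fin using (Fin)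
open import Data.Fin.Properties using () renaming (_≟_ to _≟ᶠ_)
open import Data.List using (List; []; _∷_; map; foldr)
open import Data.List.Membership.Propositional using (_∈_)
open import Data.List.Relation.Binary.Permutation.Propositional using (_↭_)
open import Data.Vec using (Vec; lookup; _[_]≔_)
open import Data.Product using (_×_; ∃-syntax)
open import Relation.Binary.PropositionalEquality using (_≡_)
open import Relation.Binary.Construct.Closure.ReflexiveTransitive using (Star)
open import Relation.Nullary using (yes; no)

data SU : Set where
  ✓  : SU
  𝟘  : SU
  !_ : SU → SU
  ¿_ : SU → SU          -- the prefix "?"

-- a process is a finite parallel composition of subprocesses; we represent
-- it as a list of subprocesses, parallel composition = list append,
-- and processes are considered up to permutation (assoc./comm.).
SProc : Set
SProc = List SU

data _⟶ₛ_ : SProc → SProc → Set where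
  sync : ∀ {P} U₁ U₂ R → P ↭ ((! U₁) ∷ (¿ U₂) ∷ R) → P ⟶ₛ (U₁ ∷ U₂ ∷ R)

_⟶ₛ*_ : SProc → SProc → Set
_⟶ₛ*_ = Star _⟶ₛ_

SSuccessful : SProc → Set
SSuccessful P = ✓ ∈ P

SMay : SProc → Set
SMay P = ∃[ Q ] (P ⟶ₛ* Q × SSuccessful Q)

SMust : SProc → Set
SMust P = ∀ Q → P ⟶ₛ* Q → SMay Q

data Sym (k : ℕ) : Set where
  Pᵢ : Fin k → Sym k
  Tᵢ : Fin k → Sym k

data LU (k : ℕ) : Set where
  𝟘  : LU k
  ✓  : LU k
  _·_ : Sym k → LU k → LU k

LProc : ℕ → Set
LProc k = List (LU k)

-- lock contents: □ empty, ■ full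
data Lock : Set where
  □ ■ : Lock

Store : ℕ → Set
Store k = Vec Lock k

LState : ℕ → Set
LState k = LProc k × Store k

data _⟶ₗ_ {k : ℕ} : LState k → LState k → Set where
  put  : ∀ {P C} i U R → P ↭ ((Pᵢ i · U) ∷ R) → lookup C i ≡ □ →
         (P Data.Product., C) ⟶ₗ ((U ∷ R) Data.Product., (C [ i ]≔ ■))
  take : ∀ {P C} i U R → P ↭ ((Tᵢ i · U) ∷ R) →
         (P Data.Product., C) ⟶ₗ ((U ∷ R) Data.Product., (C [ i ]≔ □))

_⟶ₗ*_ : ∀ {k} → LState k → LState k → Set
_⟶ₗ*_ = Star _⟶ₗ_

LSuccessful : ∀ {k} → LState k → Set
LSuccessful (P Data.Product., C) = ✓ ∈ P

LMayS : ∀ {k} → LState k → Set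
LMayS S = ∃[ S' ] (S ⟶ₗ* S' × LSuccessful S')

LMustS : ∀ {k} → LState k → Set
LMustS S = ∀ S' → S ⟶ₗ* S' → LMayS S'

LMay : ∀ {k} → Store k → LProc k → Set
LMay IS P = LMayS (P Data.Product., IS)

LMust : ∀ {k} → Store k → LProc k → Set
LMust IS P = LMustS (P Data.Product., IS)

-- Compositional translations: determined by the strings τ(!) and τ(?)

record Translation (k : ℕ) : Set where
  field
    τ! : List (Sym k)
    τ? : List (Sym k)

prefix : ∀ {k} → List (Sym k) → LU k → LU k
prefix r U = foldr _·_ U r

module _ {k : ℕ} (τ : Translation k) where
  open Translation τ

  τU : SU → LU k
  τU ✓     = ✓
  τU 𝟘     = 𝟘
  τU (! U) = prefix τ! (τU U)
  τU (¿ U) = prefix τ? (τU U)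

  τP : SProc → LProc k
  τP = map τU

Correct : ∀ {k} → Store k → Translation k → Set
Correct IS τ = ∀ (P : SProc) →
  ((SMay P → LMay IS (τP τ P)) × (LMay IS (τP τ P) → SMay P)) ×
  ((SMust P → LMust IS (τP τ P)) × (LMust IS (τP τ P) → SMust P))

_≟ˢ_ : ∀ {k} → (a b : Sym k) → Relation.Nullary.Dec (a ≡ b)
Pᵢ i ≟ˢ Pᵢ j with i ≟ᶠ j
... | yes Relation.Binary.PropositionalEquality.refl = yes Relation.Binary.PropositionalEquality.refl
... | no ne = no λ { Relation.Binary.PropositionalEquality.refl → ne Relation.Binary.PropositionalEquality.refl }
Tᵢ i ≟ˢ Tᵢ j with i ≟ᶠ j
... | yes Relation.Binary.PropositionalEquality.refl = yes Relation.Binary.PropositionalEquality.refl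
... | no ne = no λ { Relation.Binary.PropositionalEquality.refl → ne Relation.Binary.PropositionalEquality.refl }
Pᵢ i ≟ˢ Tᵢ j = no λ ()
Tᵢ i ≟ˢ Pᵢ j = no λ ()

#⟨_,_⟩ : ∀ {k} → Sym k → List (Sym k) → ℕ
#⟨ S , [] ⟩ = zero
#⟨ S , s ∷ r ⟩ with s ≟ˢ S
... | yes _ = suc #⟨ S , r ⟩
... | no  _ = #⟨ S , r ⟩

-- Suppose τ(!)τ(?) contains p occurrences of Pᵢ and only t < p occurrences of Tᵢ.
-- The SYNCSIMPLE process (!?)ⁿ✓ ∥ (?!)ⁿ0 is may-convergent, so some run of its
-- translation executes all of (τ(!)τ(?))ⁿ in the first thread together with a prefix
-- of (τ(?)τ(!))ⁿ in the second.  Every Pᵢ executed fills lock i and must be matched by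
-- an earlier Tᵢ or by the initially empty lock, so the run executes at most one more
-- Pᵢ than Tᵢ.  The first thread alone executes n(p − t) more Pᵢ than Tᵢ, while a prefix
-- of (τ(?)τ(!))ⁿ has at most t more Tᵢ than Pᵢ; hence n(p − t) ≤ t + 1, which fails for
-- n = t + 2.
module Submission where

open import Defs
open import Data.Nat using (ℕ; _≤_; _+_)
open import Data.Fin using (Fin)

open import Data.Nat using (suc; _*_; z≤n; s≤s)
open import Data.Nat.Properties
open import Data.Nat.Tactic.RingSolver using (solve-∀)
open import Data.Fin.Properties using () renaming (_≟_ to _≟ᶠ_)
open import Data.List using (List; []; _∷_; _++_; [_]; concat; replicate; length; filter)
open import Data.List.Properties using (foldr-++; ∷-injective; ++-identityʳ)
open import Data.List.Membership.Propositional using (_∈_)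
open import Data.List.Relation.Unary.Any using (here; there)
open import Data.List.Relation.Binary.Permutation.Propositional
  using (_↭_; prep; swap; ↭-refl; ↭-reflexive; ↭-trans; ↭-sym)
open import Data.List.Relation.Binary.Permutation.Propositional.Properties
  using (∈-resp-↭; drop-∷; ↭-length; filter-↭; shift)
open import Data.Vec using (lookup)
open import Data.Vec.Properties using (lookup∘update; lookup∘update′)
open import Data.Product using (_×_; _,_; proj₁; ∃; ∃₂)
open import Data.Sum using (_⊎_; inj₁; inj₂; [_,_]′)
open import Function using (id)
open import Relation.Nullary using (yes; no)
open import Relation.Binary.PropositionalEquality
  using (_≡_; refl; sym; trans; cong; cong₂; subst; subst₂; module ≡-Reasoning)
open import Relation.Binary.Construct.Closure.ReflexiveTransitive using (ε; _◅_)

module _ {k : ℕ} where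

  #-++ : (S : Sym k) (xs ys : List (Sym k)) → #⟨ S , xs ++ ys ⟩ ≡ #⟨ S , xs ⟩ + #⟨ S , ys ⟩
  #-++ S []       ys = refl
  #-++ S (x ∷ xs) ys with x ≟ˢ S
  ... | yes _ = cong suc (#-++ S xs ys)
  ... | no  _ = #-++ S xs ys

  #≡length-filter : (S : Sym k) (xs : List (Sym k)) → #⟨ S , xs ⟩ ≡ length (filter (_≟ˢ S) xs)
  #≡length-filter S []       = refl
  #≡length-filter S (x ∷ xs) with x ≟ˢ S
  ... | yes _ = cong suc (#≡length-filter S xs)
  ... | no  _ = #≡length-filter S xs

  #-resp-↭ : (S : Sym k) {xs ys : List (Sym k)} → xs ↭ ys → #⟨ S , xs ⟩ ≡ #⟨ S , ys ⟩
  #-resp-↭ S {xs} {ys} xs↭ys = begin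
    #⟨ S , xs ⟩                     ≡⟨ #≡length-filter S xs ⟩
    length (filter (_≟ˢ S) xs)      ≡⟨ ↭-length (filter-↭ (_≟ˢ S) xs↭ys) ⟩
    length (filter (_≟ˢ S) ys)      ≡⟨ sym (#≡length-filter S ys) ⟩
    #⟨ S , ys ⟩                     ∎
    where open ≡-Reasoning

  #-concat-replicate : (S : Sym k) (n : ℕ) (w : List (Sym k)) →
    #⟨ S , concat (replicate n w) ⟩ ≡ n * #⟨ S , w ⟩
  #-concat-replicate S 0       w = refl
  #-concat-replicate S (suc n) w =
    trans (#-++ S w _) (cong (#⟨ S , w ⟩ +_) (#-concat-replicate S n w))

++-split : {A : Set} (xs ys us vs : List A) → xs ++ ys ≡ us ++ vs →
  (∃ λ m → us ≡ xs ++ m) ⊎ (∃ λ q → xs ≡ us ++ q × q ++ ys ≡ vs)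
++-split []       ys us       vs eq = inj₁ (us , refl)
++-split (x ∷ xs) ys []       vs eq = inj₂ (x ∷ xs , refl , eq)
++-split (x ∷ xs) ys (u ∷ us) vs eq with ∷-injective eq
... | refl , eq′ with ++-split xs ys us vs eq′
...   | inj₁ (m , us≡)          = inj₁ (m , cong (x ∷_) us≡)
...   | inj₂ (q , xs≡ , q++ys≡) = inj₂ (q , cong (x ∷_) xs≡ , q++ys≡)

-- Across whole blocks S never gains on S′, so only the last, partial block can let
-- it get ahead, by at most its count in one block.
#-prefix-concat-replicate : ∀ {k} (S S′ : Sym k) (v : List (Sym k)) →
  #⟨ S , v ⟩ ≤ #⟨ S′ , v ⟩ →
  ∀ n pre suf → pre ++ suf ≡ concat (replicate n v) →
  #⟨ S , pre ⟩ ≤ #⟨ S′ , pre ⟩ + #⟨ S , v ⟩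
#-prefix-concat-replicate S S′ v v-ok 0       []      suf eq = z≤n
#-prefix-concat-replicate S S′ v v-ok (suc n) pre suf eq with ++-split pre suf v _ eq
... | inj₁ (m , refl) = begin
  #⟨ S , pre ⟩                      ≤⟨ m≤m+n _ _ ⟩
  #⟨ S , pre ⟩ + #⟨ S , m ⟩         ≡⟨ sym (#-++ S pre m) ⟩
  #⟨ S , pre ++ m ⟩                 ≤⟨ m≤n+m _ _ ⟩
  #⟨ S′ , pre ⟩ + #⟨ S , pre ++ m ⟩ ∎
  where open ≤-Reasoning
... | inj₂ (q , refl , q++suf≡) = begin
  #⟨ S , v ++ q ⟩                               ≡⟨ #-++ S v q ⟩
  #⟨ S , v ⟩ + #⟨ S , q ⟩                       ≤⟨ +-mono-≤ v-ok (#-prefix-concat-replicate S S′ v v-ok n q suf q++suf≡) ⟩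
  #⟨ S′ , v ⟩ + (#⟨ S′ , q ⟩ + #⟨ S , v ⟩)      ≡⟨ +-assoc (#⟨ S′ , v ⟩) _ _ ⟨
  #⟨ S′ , v ⟩ + #⟨ S′ , q ⟩ + #⟨ S , v ⟩        ≡⟨ cong (_+ #⟨ S , v ⟩) (sym (#-++ S′ v q)) ⟩
  #⟨ S′ , v ++ q ⟩ + #⟨ S , v ⟩                 ∎
  where open ≤-Reasoning

balance-trans : ∀ a b c d {u v w} → a + u ≤ b + v → c + v ≤ d + w → (a + c) + u ≤ (b + d) + w
balance-trans a b c d {u} {v} {w} ab cd = begin
  (a + c) + u   ≡⟨ left a c u ⟩
  c + (a + u)   ≤⟨ +-monoʳ-≤ c ab ⟩
  c + (b + v)   ≡⟨ middle c b v ⟩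
  b + (c + v)   ≤⟨ +-monoʳ-≤ b cd ⟩
  b + (d + w)   ≡⟨ sym (+-assoc b d w) ⟩
  (b + d) + w   ∎
  where
  open ≤-Reasoning
  left : ∀ a c u → (a + c) + u ≡ c + (a + u)
  left = solve-∀
  middle : ∀ c b v → c + (b + v) ≡ b + (c + v)
  middle = solve-∀

-- With n = 2 + t, the bound says n p ≤ n t + t + 1 < n (t + 1).
≤-from-scaled-bound : ∀ t p q r → (2 + t) * p + q ≤ (2 + t) * t + r + 1 → r ≤ q + t → p ≤ t
≤-from-scaled-bound t p q r bound r≤q+t = m<1+n⇒m≤n (*-cancelˡ-< (2 + t) p (suc t) (+-cancelʳ-≤ q _ _ (begin
  suc ((2 + t) * p) + q         ≡⟨ +-comm 1 _ ⟩
  (2 + t) * p + q + 1           ≤⟨ +-monoˡ-≤ 1 (≤-trans bound (+-monoˡ-≤ 1 (+-monoʳ-≤ _ r≤q+t))) ⟩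
  (2 + t) * t + (q + t) + 1 + 1 ≡⟨ shuffle t q ⟩
  (2 + t) * suc t + q           ∎)))
  where
  open ≤-Reasoning
  shuffle : ∀ t q → (2 + t) * t + (q + t) + 1 + 1 ≡ (2 + t) * suc t + q
  shuffle = solve-∀

tokens : Lock → ℕ
tokens □ = 0
tokens ■ = 1

tokens≤1 : ∀ l → tokens l ≤ 1
tokens≤1 □ = z≤n
tokens≤1 ■ = s≤s z≤n

module _ {k : ℕ} where

  held : Fin k → LState k → ℕ
  held i (_ , C) = tokens (lookup C i)

  fired : {S S′ : LState k} → S ⟶ₗ S′ → Sym k
  fired (put  i _ _ _ _) = Pᵢ i
  fired (take i _ _ _)   = Tᵢ i

  trace : {S S′ : LState k} → S ⟶ₗ* S′ → List (Sym k)
  trace ε          = []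
  trace (st ◅ run) = fired st ∷ trace run

  step-shape : {S S′ : LState k} (st : S ⟶ₗ S′) →
    ∃₂ λ U R → proj₁ S ↭ fired st · U ∷ R × proj₁ S′ ≡ U ∷ R
  step-shape (put  _ U R P↭ _) = U , R , P↭ , refl
  step-shape (take _ U R P↭)   = U , R , P↭ , refl

  step-balance : (i : Fin k) {S S′ : LState k} (st : S ⟶ₗ S′) →
    #⟨ Pᵢ i , [ fired st ] ⟩ + held i S ≤ #⟨ Tᵢ i , [ fired st ] ⟩ + held i S′
  step-balance i (put {C = C} j _ _ _ free) with j ≟ᶠ i
  ... | yes refl rewrite free | lookup∘update j C ■ = ≤-refl
  ... | no j≢i rewrite lookup∘update′ (λ i≡j → j≢i (sym i≡j)) C ■ = ≤-refl
  step-balance i (take {C = C} j _ _ _) with j ≟ᶠ i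
  ... | yes refl rewrite lookup∘update j C □ = tokens≤1 (lookup C j)
  ... | no j≢i rewrite lookup∘update′ (λ i≡j → j≢i (sym i≡j)) C □ = ≤-refl

  -- Every Pᵢ fired fills lock i, which only a Tᵢ or the initial store can have emptied.
  run-balance : (i : Fin k) {S S′ : LState k} (run : S ⟶ₗ* S′) →
    #⟨ Pᵢ i , trace run ⟩ + held i S ≤ #⟨ Tᵢ i , trace run ⟩ + held i S′
  run-balance i ε          = ≤-refl
  run-balance i {S} {S′} (st ◅ run) = begin
    #P (f ∷ e) + held i S        ≡⟨ cong (_+ held i S) (#-++ (Pᵢ i) [ f ] e) ⟩
    #P [ f ] + #P e + held i S   ≤⟨ balance-trans (#P [ f ]) (#T [ f ]) (#P e) (#T e)
                                      (step-balance i st) (run-balance i run) ⟩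
    #T [ f ] + #T e + held i S′  ≡⟨ cong (_+ held i S′) (#-++ (Tᵢ i) [ f ] e) ⟨
    #T (f ∷ e) + held i S′       ∎
    where
    open ≤-Reasoning
    f : Sym k
    f = fired st
    e : List (Sym k)
    e = trace run
    #P #T : List (Sym k) → ℕ
    #P = #⟨ Pᵢ i ,_⟩
    #T = #⟨ Tᵢ i ,_⟩

  ↭-pair-inv : {x a b : LU k} {R : LProc k} → x ∷ R ↭ a ∷ b ∷ [] →
    (x ≡ a × R ↭ [ b ]) ⊎ (x ≡ b × R ↭ [ a ])
  ↭-pair-inv {a = a} {b} p with ∈-resp-↭ p (here refl)
  ... | here refl         = inj₁ (refl , drop-∷ p)
  ... | there (here refl) = inj₂ (refl , drop-∷ (↭-trans p (swap a b ↭-refl)))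

  prefix-inv : ∀ r E {s : Sym k} {U} → s · U ≡ prefix r E →
    E ≡ s · U ⊎ ∃ λ r′ → r ≡ s ∷ r′ × U ≡ prefix r′ E
  prefix-inv []      E eq   = inj₁ (sym eq)
  prefix-inv (_ ∷ r) E refl = inj₂ (r , refl , refl)

  -- P is what is left of the threads prefix a ✓ and prefix b 𝟘 after firing e,
  -- an interleaving of a prefix of a with a prefix of b.
  record Interleaved (a b e : List (Sym k)) (P : LProc k) : Set where
    field
      doneᵃ restᵃ doneᵇ restᵇ : List (Sym k)
      splitᵃ       : a ≡ doneᵃ ++ restᵃ
      splitᵇ       : b ≡ doneᵇ ++ restᵇ
      remaining    : P ↭ prefix restᵃ ✓ ∷ prefix restᵇ 𝟘 ∷ []
      interleaving : e ↭ doneᵃ ++ doneᵇ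

  open Interleaved

  fire-first : ∀ {a b e P} s → Interleaved a b e P → Interleaved (s ∷ a) b (s ∷ e) P
  fire-first s I = record
    { doneᵃ = s ∷ doneᵃ I ; restᵃ = restᵃ I ; doneᵇ = doneᵇ I ; restᵇ = restᵇ I
    ; splitᵃ = cong (s ∷_) (splitᵃ I) ; splitᵇ = splitᵇ I ; remaining = remaining I
    ; interleaving = prep s (interleaving I) }

  fire-second : ∀ {a b e P} s → Interleaved a b e P → Interleaved a (s ∷ b) (s ∷ e) P
  fire-second s I = record
    { doneᵃ = doneᵃ I ; restᵃ = restᵃ I ; doneᵇ = s ∷ doneᵇ I ; restᵇ = restᵇ I
    ; splitᵃ = splitᵃ I ; splitᵇ = cong (s ∷_) (splitᵇ I) ; remaining = remaining I
    ; interleaving = ↭-trans (prep s (interleaving I)) (↭-sym (shift s (doneᵃ I) (doneᵇ I))) }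

  two-thread-run : ∀ a b {S S′ : LState k} (run : S ⟶ₗ* S′) →
    proj₁ S ↭ prefix a ✓ ∷ prefix b 𝟘 ∷ [] → Interleaved a b (trace run) (proj₁ S′)
  two-thread-run a b ε P↭ = record
    { doneᵃ = [] ; restᵃ = a ; doneᵇ = [] ; restᵇ = b
    ; splitᵃ = refl ; splitᵇ = refl ; remaining = P↭ ; interleaving = ↭-refl }
  two-thread-run a b (st ◅ run) P↭ with step-shape st
  ... | U , R , P↭UR , P′≡UR with ↭-pair-inv (↭-trans (↭-sym P↭UR) P↭)
  ...   | inj₁ (U-first , R↭) with prefix-inv a ✓ U-first
  ...     | inj₁ ()
  ...     | inj₂ (a′ , refl , refl) =
    fire-first (fired st) (two-thread-run a′ b run (↭-trans (↭-reflexive P′≡UR) (prep _ R↭)))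
  two-thread-run a b (st ◅ run) P↭
      | U , R , P↭UR , P′≡UR | inj₂ (U-second , R↭) with prefix-inv b 𝟘 U-second
  ...     | inj₁ ()
  ...     | inj₂ (b′ , refl , refl) =
    fire-second (fired st)
      (two-thread-run a b′ run (↭-trans (↭-reflexive P′≡UR) (↭-trans (prep _ R↭) (swap _ _ ↭-refl))))

  ✓∈-two-threads : ∀ {a b : List (Sym k)} → ✓ ∈ prefix a ✓ ∷ prefix b 𝟘 ∷ [] → a ≡ []
  ✓∈-two-threads {[]}            _                 = refl
  ✓∈-two-threads {_ ∷ _}         (here ())
  ✓∈-two-threads {_ ∷ _} {[]}    (there (here ()))
  ✓∈-two-threads {_ ∷ _} {_ ∷ _} (there (here ()))

  completed-thread-balance : (i : Fin k) (a b : List (Sym k)) {P P′ : LProc k} {C C′ : Store k} →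
    (run : (P , C) ⟶ₗ* (P′ , C′)) → P ↭ prefix a ✓ ∷ prefix b 𝟘 ∷ [] → ✓ ∈ P′ →
    ∃₂ λ pre suf → b ≡ pre ++ suf ×
      #⟨ Pᵢ i , a ⟩ + #⟨ Pᵢ i , pre ⟩ ≤ #⟨ Tᵢ i , a ⟩ + #⟨ Tᵢ i , pre ⟩ + 1
  completed-thread-balance i a b {P′ = P′} {C} {C′} run P↭ success =
    doneᵇ I , restᵇ I , splitᵇ I , (begin
      #⟨ Pᵢ i , a ⟩ + #⟨ Pᵢ i , doneᵇ I ⟩          ≡⟨ count (Pᵢ i) ⟨
      #⟨ Pᵢ i , trace run ⟩                         ≤⟨ m≤m+n _ _ ⟩
      #⟨ Pᵢ i , trace run ⟩ + tokens (lookup C i)   ≤⟨ run-balance i run ⟩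
      #⟨ Tᵢ i , trace run ⟩ + tokens (lookup C′ i)  ≤⟨ +-monoʳ-≤ _ (tokens≤1 _) ⟩
      #⟨ Tᵢ i , trace run ⟩ + 1                     ≡⟨ cong (_+ 1) (count (Tᵢ i)) ⟩
      #⟨ Tᵢ i , a ⟩ + #⟨ Tᵢ i , doneᵇ I ⟩ + 1      ∎)
    where
    open ≤-Reasoning
    I : Interleaved a b (trace run) P′
    I = two-thread-run a b run P↭
    restᵃ≡[] : restᵃ I ≡ []
    restᵃ≡[] = ✓∈-two-threads {restᵃ I} {restᵇ I} (∈-resp-↭ (remaining I) success)
    a≡doneᵃ : a ≡ doneᵃ I
    a≡doneᵃ = trans (splitᵃ I) (trans (cong (doneᵃ I ++_) restᵃ≡[]) (++-identityʳ _))
    count : ∀ S → #⟨ S , trace run ⟩ ≡ #⟨ S , a ⟩ + #⟨ S , doneᵇ I ⟩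
    count S = trans (#-resp-↭ S (interleaving I))
      (trans (#-++ S (doneᵃ I) (doneᵇ I)) (cong (λ w → #⟨ S , w ⟩ + #⟨ S , doneᵇ I ⟩) (sym a≡doneᵃ)))

sendRecv recvSend : ℕ → SU
sendRecv 0       = ✓
sendRecv (suc n) = ! ¿ sendRecv n
recvSend 0       = 𝟘
recvSend (suc n) = ¿ ! recvSend n

recvSend∥sendRecv-may : ∀ n → SMay (recvSend n ∷ sendRecv n ∷ [])
recvSend∥sendRecv-may n = 𝟘 ∷ ✓ ∷ [] , rounds n , there (here refl)
  where
  rounds : ∀ n → (recvSend n ∷ sendRecv n ∷ []) ⟶ₛ* (𝟘 ∷ ✓ ∷ [])
  rounds 0       = ε
  rounds (suc n) = sync _ _ [] (swap _ _ ↭-refl) ◅ sync _ _ [] (swap _ _ ↭-refl) ◅ rounds n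

prefix-++-++ : ∀ {k} (r r′ r″ : List (Sym k)) (E : LU k) →
  prefix ((r ++ r′) ++ r″) E ≡ prefix r (prefix r′ (prefix r″ E))
prefix-++-++ r r′ r″ E = trans (foldr-++ _·_ E (r ++ r′) r″) (foldr-++ _·_ (prefix r″ E) r r′)

module _ {k : ℕ} (τ : Translation k) where
  open Translation τ

  τ-sendRecv : ∀ n → τU τ (sendRecv n) ≡ prefix (concat (replicate n (τ! ++ τ?))) ✓
  τ-sendRecv 0       = refl
  τ-sendRecv (suc n) =
    trans (cong (λ U → prefix τ! (prefix τ? U)) (τ-sendRecv n)) (sym (prefix-++-++ τ! τ? _ ✓))

  τ-recvSend : ∀ n → τU τ (recvSend n) ≡ prefix (concat (replicate n (τ? ++ τ!))) 𝟘
  τ-recvSend 0       = refl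
  τ-recvSend (suc n) =
    trans (cong (λ U → prefix τ? (prefix τ! U)) (τ-recvSend n)) (sym (prefix-++-++ τ? τ! _ 𝟘))

  may-balanced : (IS : Store k) (i : Fin k) →
    (∀ n → LMay IS (τP τ (recvSend n ∷ sendRecv n ∷ []))) →
    #⟨ Pᵢ i , τ! ⟩ + #⟨ Pᵢ i , τ? ⟩ ≤ #⟨ Tᵢ i , τ! ⟩ + #⟨ Tᵢ i , τ? ⟩
  may-balanced IS i may = [ id , excess-refuted ]′ (≤-total p t)
    where
    #P #T : List (Sym k) → ℕ
    #P = #⟨ Pᵢ i ,_⟩
    #T = #⟨ Tᵢ i ,_⟩
    p t n : ℕ
    p = #P τ! + #P τ?
    t = #T τ! + #T τ?
    n = 2 + t
    wA wB : List (Sym k)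
    wA = concat (replicate n (τ! ++ τ?))
    wB = concat (replicate n (τ? ++ τ!))
    #-rounds : ∀ S → #⟨ S , wA ⟩ ≡ n * (#⟨ S , τ! ⟩ + #⟨ S , τ? ⟩)
    #-rounds S = trans (#-concat-replicate S n (τ! ++ τ?)) (cong (n *_) (#-++ S τ! τ?))
    #-swapped : ∀ S → #⟨ S , τ? ++ τ! ⟩ ≡ #⟨ S , τ! ⟩ + #⟨ S , τ? ⟩
    #-swapped S = trans (#-++ S τ? τ!) (+-comm #⟨ S , τ? ⟩ #⟨ S , τ! ⟩)
    start : τP τ (recvSend n ∷ sendRecv n ∷ []) ↭ prefix wA ✓ ∷ prefix wB 𝟘 ∷ []
    start = ↭-trans (swap (τU τ (recvSend n)) (τU τ (sendRecv n)) ↭-refl)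
      (↭-reflexive (cong₂ (λ A B → A ∷ B ∷ []) (τ-sendRecv n) (τ-recvSend n)))
    excess-refuted : t ≤ p → p ≤ t
    excess-refuted t≤p with may n
    ... | _ , run , success with completed-thread-balance i wA wB run start success
    ... | pre , suf , split , bound = ≤-from-scaled-bound t p (#P pre) (#T pre) scaled prefix-bound
      where
      scaled : n * p + #P pre ≤ n * t + #T pre + 1
      scaled = subst₂ (λ P T → P + #P pre ≤ T + #T pre + 1) (#-rounds (Pᵢ i)) (#-rounds (Tᵢ i)) bound
      block-ok : #T (τ? ++ τ!) ≤ #P (τ? ++ τ!)
      block-ok = subst₂ _≤_ (sym (#-swapped (Tᵢ i))) (sym (#-swapped (Pᵢ i))) t≤p
      prefix-bound : #T pre ≤ #P pre + t
      prefix-bound = subst (λ T → #T pre ≤ #P pre + T) (#-swapped (Tᵢ i))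
        (#-prefix-concat-replicate (Tᵢ i) (Pᵢ i) (τ? ++ τ!) block-ok n pre suf (sym split))

proposition4p2 : (k : ℕ) → 2 ≤ k → (IS : Store k) → (τ : Translation k) →
    Correct IS τ → (i : Fin k) →
    #⟨ Pᵢ i , Translation.τ! τ ⟩ + #⟨ Pᵢ i , Translation.τ? τ ⟩
    ≤ #⟨ Tᵢ i , Translation.τ! τ ⟩ + #⟨ Tᵢ i , Translation.τ? τ ⟩
proposition4p2 k _ IS τ correct i =
  may-balanced τ IS i λ n → proj₁ (proj₁ (correct _)) (recvSend∥sendRecv-may n)
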